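{- Let $G$ be a (gem, co-gem)-free graph whose vertex set is partitioned into six nonempty sets $A_1,\dots,A_6$ such that $A_1,A_2,A_3,A_4$ are cliques, $A_1$ is complete to $A_2\cup A_5$ and anti-complete to $A_3\cup A_4\cup A_6$, $A_2$ is complete to $A_1\cup A_3\cup A_6$ and anti-complete to $A_4\cup A_5$, $A_3$ is complete to $A_2\cup A_4\cup A_6$ and anti-complete to $A_1\cup A_5$, and $A_4$ is complete to $A_3\cup A_5$ and anti-complete to $A_1\cup A_2\cup A_6$ (adjacencies between $A_5$ and $A_6$ are arbitrary). Suppose $\chi(G)=k$ and let $c$ be a $k$-coloring of $G$. Let $\{i,i'\}=\{1,4\}$ and let $j,j'\in\{1,\dots,k\}$ be colors with $j'\in c(A_6)\setminus c(A_i)$ and $j\in c(A_i)\setminus c(A_6)$. Then a new $k$-coloring of $G$ in which $j\notin c(A_i)$ and $j'\in c(A_i)\cap c(A_6)$ can be obtained from $c$ by performing one of the following operations: (i) changing the color of a vertex in $A_i$ from $j$ to $j'$; or (ii) swapping the colors of the vertices in $A_i^{j}$ and $A_5^{j'}$ (i.e., recoloring the vertices of $A_i$ colored $j$ with $j'$ and the vertices of $A_5$ colored $j'$ with $j$), and, if there is a vertex in $A_{i'}$ with color $j$, changing the color of this vertex to $j'$.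
   Context: All graphs are finite and simple. A $k$-coloring is a map $c:V(G)\to\{1,\dots,k\}$ with $c(x)\ne c(y)$ whenever $x\sim y$; $\chi(G)$ is the least such $k$. For $S\subseteq V(G)$, $c(S)$ is the set of colors used on $S$ and $S^j$ is the set of vertices of $S$ colored $j$. A set $A$ is complete (anti-complete) to $B$ if every (no) vertex of $A$ is adjacent to every (any) vertex of $B$. The co-gem is $P_4+P_1$ and the gem is its complement. -}

module Defs where

open import Data.Nat using (ℕ; _≤_)
open import Data.Bool using (Bool; true; false; not; if_then_else_)
open import Data.Fin using (Fin; toℕ; #_; _≟_)
open import Data.Product using (Σ; ∃; _×_; _,_)
open import Data.Sum using (_⊎_)
open import Relation.Nullary using (¬_)
open import Relation.Nullary.Decidable using (⌊_⌋)
open import Relation.Binary.PropositionalEquality using (_≡_; _≢_)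
open import Function.Definitions using (Injective)

record Graph : Set where
  field
    n      : ℕ
    adj    : Fin n → Fin n → Bool
    sym    : ∀ x y → adj x y ≡ adj y x
    irrefl : ∀ x → adj x x ≡ false
open Graph public

Vertex : Graph → Set
Vertex G = Fin (n G)

Edge : (G : Graph) → Vertex G → Vertex G → Set
Edge G x y = adj G x y ≡ true

-- Colorings with colors Fin k (standing for {1,…,k}).
IsColoring : (G : Graph) (k : ℕ) → (Vertex G → Fin k) → Set
IsColoring G k c = ∀ x y → Edge G x y → c x ≢ c y

Colorable : Graph → ℕ → Set
Colorable G k = Σ (Vertex G → Fin k) (IsColoring G k)

ChromaticNumber : Graph → ℕ → Set
ChromaticNumber G k = Colorable G k × (∀ m → Colorable G m → k ≤ m)

Pattern5 : Set
Pattern5 = Fin 5 → Fin 5 → Bool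

HasInduced : (G : Graph) → Pattern5 → Set
HasInduced G H =
  Σ (Fin 5 → Vertex G) λ f → Injective _≡_ _≡_ f × (∀ a b → adj G (f a) (f b) ≡ H a b)

p4 : ℕ → ℕ → Bool
p4 0 1 = true
p4 1 0 = true
p4 1 2 = true
p4 2 1 = true
p4 2 3 = true
p4 3 2 = true
p4 _ _ = false

-- co-gem = P4 + P1 : path 0-1-2-3, vertex 4 isolated
cogem : Pattern5
cogem a b = p4 (toℕ a) (toℕ b)

gem : Pattern5
gem a b = if ⌊ a ≟ b ⌋ then false else not (cogem a b)

GemCogemFree : Graph → Set
GemCogemFree G = ¬ HasInduced G gem × ¬ HasInduced G cogem

-- Partition of V(G) into parts indexed by Fin 6 (part 0 = A₁, …, part 5 = A₆).
Part : Graph → Set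
Part G = Vertex G → Fin 6

Clique : (G : Graph) → Part G → Fin 6 → Set
Clique G P p = ∀ x y → P x ≡ p → P y ≡ p → x ≢ y → Edge G x y

Complete : (G : Graph) → Part G → Fin 6 → Fin 6 → Set
Complete G P p q = ∀ x y → P x ≡ p → P y ≡ q → Edge G x y

AntiComplete : (G : Graph) → Part G → Fin 6 → Fin 6 → Set
AntiComplete G P p q = ∀ x y → P x ≡ p → P y ≡ q → adj G x y ≡ false

record SixStructure (G : Graph) (P : Part G) : Set where
  field
    nonempty : ∀ p → ∃ λ x → P x ≡ p
    clq1 : Clique G P (# 0)
    clq2 : Clique G P (# 1)
    clq3 : Clique G P (# 2)
    clq4 : Clique G P (# 3)
    c12 : Complete G P (# 0) (# 1)
    c15 : Complete G P (# 0) (# 4)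
    a13 : AntiComplete G P (# 0) (# 2)
    a14 : AntiComplete G P (# 0) (# 3)
    a16 : AntiComplete G P (# 0) (# 5)
    c21 : Complete G P (# 1) (# 0)
    c23 : Complete G P (# 1) (# 2)
    c26 : Complete G P (# 1) (# 5)
    a24 : AntiComplete G P (# 1) (# 3)
    a25 : AntiComplete G P (# 1) (# 4)
    c32 : Complete G P (# 2) (# 1)
    c34 : Complete G P (# 2) (# 3)
    c36 : Complete G P (# 2) (# 5)
    a31 : AntiComplete G P (# 2) (# 0)
    a35 : AntiComplete G P (# 2) (# 4)
    c43 : Complete G P (# 3) (# 2)
    c45 : Complete G P (# 3) (# 4)
    a41 : AntiComplete G P (# 3) (# 0)
    a42 : AntiComplete G P (# 3) (# 1)
    a46 : AntiComplete G P (# 3) (# 5)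

UsesColor : (G : Graph) (P : Part G) {k : ℕ} → (Vertex G → Fin k) → Fin 6 → Fin k → Set
UsesColor G P c p j = ∃ λ x → P x ≡ p × c x ≡ j

OpI : (G : Graph) (P : Part G) {k : ℕ} (c c' : Vertex G → Fin k) (i : Fin 6) (j j' : Fin k) → Set
OpI G P c c' i j j' =
  ∃ λ v → P v ≡ i × c v ≡ j × c' v ≡ j' × (∀ w → w ≢ v → c' w ≡ c w)

SwapAt : (G : Graph) (P : Part G) {k : ℕ} (c : Vertex G → Fin k) (i : Fin 6) (j j' : Fin k)
         (w : Vertex G) (d : Fin k) → Set
SwapAt G P c i j j' w d =
  (P w ≡ i × c w ≡ j × d ≡ j')
  ⊎ (P w ≡ # 4 × c w ≡ j' × d ≡ j)
  ⊎ (¬ (P w ≡ i × c w ≡ j) × ¬ (P w ≡ # 4 × c w ≡ j') × d ≡ c w)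

OpII : (G : Graph) (P : Part G) {k : ℕ} (c c' : Vertex G → Fin k) (i i' : Fin 6) (j j' : Fin k) → Set
OpII G P c c' i i' j j' =
  (∀ w → ¬ (P w ≡ i' × c w ≡ j) → SwapAt G P c i j j' w (c' w))
  × (∀ w → P w ≡ i' → c w ≡ j → c' w ≡ j')

-- Both operations are Kempe-type swaps of the colours j and j': recolour a set T of
-- j-vertices with j' and a set S of j'-vertices with j, which stays proper as long as
-- every j'-neighbour of T lies in S and every j-neighbour of S lies in T.  If A₅ has no
-- j'-vertex, T is a single j-vertex of Aᵢ and S = ∅; otherwise T is the j-vertices of
-- A₁ ∪ A₄ and S those of A₅ coloured j'.  The closure conditions follow from the
-- neighbourhoods in the six-part structure: a neighbour of A₁ ∪ A₄ outside A₁ ∪ A₄ ∪ A₅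
-- lies in A₂ ∪ A₃, which is complete to the j'-vertex of A₆, and A₅ sees only
-- A₁ ∪ A₄ ∪ A₅ ∪ A₆.
module Submission where

open import Defs hiding (sym)
open import Level using (0ℓ)
open import Data.Nat using (ℕ)
open import Data.Fin using (Fin; zero; suc; #_; _≟_)
open import Data.Fin.Properties using (any?)
open import Data.Product using (Σ; ∃; _×_; _,_; proj₂)
open import Data.Sum using (_⊎_; inj₁; inj₂)
open import Data.Bool using (false)
open import Data.Empty using (⊥; ⊥-elim)
open import Relation.Nullary using (¬_; Dec; yes; no)
open import Relation.Nullary.Decidable using (_×-dec_; _⊎-dec_)
open import Relation.Unary using (Pred; Decidable; ∅; ｛_｝)
open import Relation.Unary.Properties using (∅?)
open import Relation.Binary.PropositionalEquality using (_≡_; _≢_; refl; sym; trans; cong; subst)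

edge-sym : (G : Graph) {x y : Vertex G} → Edge G x y → Edge G y x
edge-sym G {x} {y} e = trans (sym (Graph.sym G x y)) e

edge-nonAdj : (G : Graph) {x y : Vertex G} → Edge G x y → adj G x y ≡ false → ⊥
edge-nonAdj G e f with () ← trans (sym e) f

module KempeSwap (G : Graph) {k : ℕ} (c : Vertex G → Fin k) (j j' : Fin k)
  {T S : Pred (Vertex G) 0ℓ} (T? : Decidable T) (S? : Decidable S) where

  recolor : Vertex G → Fin k
  recolor w with T? w | S? w
  ... | yes _ | _     = j'
  ... | no _  | yes _ = j
  ... | no _  | no _  = c w

  recolor-cases : ∀ w → T w × recolor w ≡ j'
                      ⊎ ¬ T w × S w × recolor w ≡ j
                      ⊎ ¬ T w × ¬ S w × recolor w ≡ c w
  recolor-cases w with T? w | S? w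
  ... | yes t | _     = inj₁ (t , refl)
  ... | no ¬t | yes s = inj₂ (inj₁ (¬t , s , refl))
  ... | no ¬t | no ¬s = inj₂ (inj₂ (¬t , ¬s , refl))

  module _ (T⊆j : ∀ {w} → T w → c w ≡ j) (S⊆j' : ∀ {w} → S w → c w ≡ j')
    (T-closed : ∀ {x y} → T x → Edge G x y → c y ≡ j' → S y)
    (S-closed : ∀ {x y} → S x → Edge G x y → c y ≡ j → T y) where

    recolor-reflects : ∀ {x y} → Edge G x y → recolor x ≡ recolor y → c x ≡ c y
    recolor-reflects {x} {y} e eq with recolor-cases x | recolor-cases y
    ... | inj₁ (tx , rx) | inj₁ (ty , ry) =
      trans (T⊆j tx) (sym (T⊆j ty))
    ... | inj₁ (tx , rx) | inj₂ (inj₁ (_ , sy , ry)) =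
      trans (T⊆j tx) (trans (sym ry) (trans (sym eq) (trans rx (sym (S⊆j' sy)))))
    ... | inj₁ (tx , rx) | inj₂ (inj₂ (_ , ¬sy , ry)) =
      ⊥-elim (¬sy (T-closed tx e (trans (sym ry) (trans (sym eq) rx))))
    ... | inj₂ (inj₁ (_ , sx , rx)) | inj₁ (ty , ry) =
      trans (S⊆j' sx) (trans (sym ry) (trans (sym eq) (trans rx (sym (T⊆j ty)))))
    ... | inj₂ (inj₁ (_ , sx , rx)) | inj₂ (inj₁ (_ , sy , ry)) =
      trans (S⊆j' sx) (sym (S⊆j' sy))
    ... | inj₂ (inj₁ (_ , sx , rx)) | inj₂ (inj₂ (¬ty , _ , ry)) =
      ⊥-elim (¬ty (S-closed sx e (trans (sym ry) (trans (sym eq) rx))))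
    ... | inj₂ (inj₂ (_ , ¬sx , rx)) | inj₁ (ty , ry) =
      ⊥-elim (¬sx (T-closed ty (edge-sym G e) (trans (sym rx) (trans eq ry))))
    ... | inj₂ (inj₂ (¬tx , _ , rx)) | inj₂ (inj₁ (_ , sy , ry)) =
      ⊥-elim (¬tx (S-closed sy (edge-sym G e) (trans (sym rx) (trans eq ry))))
    ... | inj₂ (inj₂ (_ , _ , rx)) | inj₂ (inj₂ (_ , _ , ry)) =
      trans (sym rx) (trans eq ry)

    recolor-isColoring : IsColoring G k c → IsColoring G k recolor
    recolor-isColoring col x y e eq = col x y e (recolor-reflects e eq)

-- A₁ and A₄, the two ends of the path of cliques A₁A₂A₃A₄.
Outer : Fin 6 → Set
Outer p = p ≡ # 0 ⊎ p ≡ # 3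

outer? : (p : Fin 6) → Dec (Outer p)
outer? p = (p ≟ # 0) ⊎-dec (p ≟ # 3)

outer≢A₅ : ∀ {p} → Outer p → p ≢ # 4
outer≢A₅ (inj₁ refl) ()
outer≢A₅ (inj₂ refl) ()

outer≢A₆ : ∀ {p} → Outer p → p ≢ # 5
outer≢A₆ (inj₁ refl) ()
outer≢A₆ (inj₂ refl) ()

OuterPair : Fin 6 → Fin 6 → Set
OuterPair i i' = (i ≡ # 0 × i' ≡ # 3) ⊎ (i ≡ # 3 × i' ≡ # 0)

outerPair-outerˡ : ∀ {i i'} → OuterPair i i' → Outer i
outerPair-outerˡ (inj₁ (refl , _)) = inj₁ refl
outerPair-outerˡ (inj₂ (refl , _)) = inj₂ refl

outerPair-outerʳ : ∀ {i i'} → OuterPair i i' → Outer i'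
outerPair-outerʳ (inj₁ (_ , refl)) = inj₂ refl
outerPair-outerʳ (inj₂ (_ , refl)) = inj₁ refl

outerPair-cover : ∀ {i i' p} → OuterPair i i' → Outer p → p ≡ i ⊎ p ≡ i'
outerPair-cover (inj₁ (refl , refl)) (inj₁ refl) = inj₁ refl
outerPair-cover (inj₁ (refl , refl)) (inj₂ refl) = inj₂ refl
outerPair-cover (inj₂ (refl , refl)) (inj₁ refl) = inj₂ refl
outerPair-cover (inj₂ (refl , refl)) (inj₂ refl) = inj₁ refl

module Neighbourhoods {G : Graph} {P : Part G} (St : SixStructure G P) where
  open SixStructure St

  CompleteToA₆ : Vertex G → Set
  CompleteToA₆ y = ∀ z → P z ≡ # 5 → Edge G y z

  outer-neighbour : ∀ {p x y} → Outer p → P x ≡ p → Edge G x y →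
                    P y ≡ p ⊎ P y ≡ # 4 ⊎ CompleteToA₆ y
  outer-neighbour {x = x} {y} (inj₁ refl) px e with P y in py
  ... | zero = inj₁ refl
  ... | suc zero = inj₂ (inj₂ (λ z → c26 y z py))
  ... | suc (suc zero) = ⊥-elim (edge-nonAdj G e (a13 x y px py))
  ... | suc (suc (suc zero)) = ⊥-elim (edge-nonAdj G e (a14 x y px py))
  ... | suc (suc (suc (suc zero))) = inj₂ (inj₁ refl)
  ... | suc (suc (suc (suc (suc zero)))) =
    ⊥-elim (edge-nonAdj G e (a16 x y px py))
  outer-neighbour {x = x} {y} (inj₂ refl) px e with P y in py
  ... | zero = ⊥-elim (edge-nonAdj G e (a41 x y px py))
  ... | suc zero = ⊥-elim (edge-nonAdj G e (a42 x y px py))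
  ... | suc (suc zero) = inj₂ (inj₂ (λ z → c36 y z py))
  ... | suc (suc (suc zero)) = inj₁ refl
  ... | suc (suc (suc (suc zero))) = inj₂ (inj₁ refl)
  ... | suc (suc (suc (suc (suc zero)))) =
    ⊥-elim (edge-nonAdj G e (a46 x y px py))

  A₅-neighbour : ∀ {x y} → P x ≡ # 4 → Edge G x y → Outer (P y) ⊎ P y ≡ # 4 ⊎ P y ≡ # 5
  A₅-neighbour {x} {y} px e with P y in py
  ... | zero = inj₁ (inj₁ refl)
  ... | suc zero = ⊥-elim (edge-nonAdj G e (trans (Graph.sym G x y) (a25 y x py px)))
  ... | suc (suc zero) = ⊥-elim (edge-nonAdj G e (trans (Graph.sym G x y) (a35 y x py px)))
  ... | suc (suc (suc zero)) = inj₁ (inj₂ refl)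
  ... | suc (suc (suc (suc zero))) = inj₂ (inj₁ refl)
  ... | suc (suc (suc (suc (suc zero)))) = inj₂ (inj₂ refl)

  outer-clique : ∀ {p} → Outer p → Clique G P p
  outer-clique (inj₁ refl) = clq1
  outer-clique (inj₂ refl) = clq4

  outer-complete-A₅ : ∀ {p x y} → Outer p → P x ≡ p → P y ≡ # 4 → Edge G x y
  outer-complete-A₅ (inj₁ refl) = c15 _ _
  outer-complete-A₅ (inj₂ refl) = c45 _ _

module Recoloring {G : Graph} {P : Part G} (St : SixStructure G P)
  {k : ℕ} (c : Vertex G → Fin k) (col : IsColoring G k c)
  {i i' : Fin 6} (ends : OuterPair i i') {j j' : Fin k}
  {u₆ : Vertex G} (u₆∈A₆ : P u₆ ≡ # 5) (cu₆ : c u₆ ≡ j') (j'∉Aᵢ : ¬ UsesColor G P c i j')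
  {v : Vertex G} (v∈Aᵢ : P v ≡ i) (cv : c v ≡ j) (j∉A₆ : ¬ UsesColor G P c (# 5) j) where
  open Neighbourhoods St

  Exchanged : (Vertex G → Fin k) → Set
  Exchanged c' = IsColoring G k c'
    × ¬ UsesColor G P c' i j × UsesColor G P c' i j' × UsesColor G P c' (# 5) j'
    × (OpI G P c c' i j j' ⊎ OpII G P c c' i i' j j')

  j≢j' : j ≢ j'
  j≢j' eq = j'∉Aᵢ (v , v∈Aᵢ , trans cv eq)

  completeToA₆-≢j' : ∀ {y} → CompleteToA₆ y → c y ≢ j'
  completeToA₆-≢j' f cy = col _ u₆ (f u₆ u₆∈A₆) (trans cy (sym cu₆))

  A₅-≢j : ∀ {y} → P y ≡ # 4 → c y ≢ j
  A₅-≢j py cy = col v _ (outer-complete-A₅ (outerPair-outerˡ ends) v∈Aᵢ py) (trans cv (sym cy))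

  outerᵢ : ∀ {w} → P w ≡ i → Outer (P w)
  outerᵢ pw = subst Outer (sym pw) (outerPair-outerˡ ends)

  recolorVertex : ¬ (∃ λ u → P u ≡ # 4 × c u ≡ j') → Σ (Vertex G → Fin k) Exchanged
  recolorVertex j'∉A₅ =
    recolor , recolor-isColoring T⊆j (λ ()) T-closed (λ ()) col , j∉Aᵢ ,
    (v , v∈Aᵢ , recolor-v) , (u₆ , u₆∈A₆ , trans (recolor-other u₆ u₆≢v) cu₆) ,
    inj₁ (v , v∈Aᵢ , cv , recolor-v , recolor-other)
    where
    open KempeSwap G c j j' {T = ｛ v ｝} {S = ∅} (v ≟_) ∅?

    T⊆j : ∀ {w} → v ≡ w → c w ≡ j
    T⊆j refl = cv

    T-closed : ∀ {x y} → v ≡ x → Edge G x y → c y ≡ j' → ⊥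
    T-closed {y = y} refl e cy with outer-neighbour (outerᵢ v∈Aᵢ) refl e
    ... | inj₁ py = j'∉Aᵢ (y , trans py v∈Aᵢ , cy)
    ... | inj₂ (inj₁ py) = j'∉A₅ (y , py , cy)
    ... | inj₂ (inj₂ f) = completeToA₆-≢j' f cy

    recolor-v : recolor v ≡ j'
    recolor-v with recolor-cases v
    ... | inj₁ (_ , r) = r
    ... | inj₂ (inj₁ (¬t , _)) = ⊥-elim (¬t refl)
    ... | inj₂ (inj₂ (¬t , _)) = ⊥-elim (¬t refl)

    recolor-other : ∀ w → w ≢ v → recolor w ≡ c w
    recolor-other w w≢v with recolor-cases w
    ... | inj₁ (v≡w , _) = ⊥-elim (w≢v (sym v≡w))
    ... | inj₂ (inj₂ (_ , _ , r)) = r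

    u₆≢v : u₆ ≢ v
    u₆≢v u₆≡v = outer≢A₆ (outerᵢ v∈Aᵢ) (trans (cong P (sym u₆≡v)) u₆∈A₆)

    j∉Aᵢ : ¬ UsesColor G P recolor i j
    j∉Aᵢ (w , w∈Aᵢ , rw) with recolor-cases w
    ... | inj₁ (_ , r) = j≢j' (trans (sym rw) r)
    ... | inj₂ (inj₂ (v≢w , _ , r)) =
      col v w (outer-clique (outerPair-outerˡ ends) v w v∈Aᵢ w∈Aᵢ v≢w) (trans cv (sym (trans (sym r) rw)))

  swapWithA₅ : ∀ {u₅} → P u₅ ≡ # 4 → c u₅ ≡ j' → Σ (Vertex G → Fin k) Exchanged
  swapWithA₅ {u₅} u₅∈A₅ cu₅ =
    recolor , recolor-isColoring proj₂ proj₂ T-closed S-closed col , j∉Aᵢ ,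
    (v , v∈Aᵢ , recolor-v) , (u₆ , u₆∈A₆ , recolor-u₆) , inj₂ (swapAt , recolor-Aᵢ')
    where
    open KempeSwap G c j j'
      {T = λ w → Outer (P w) × c w ≡ j} {S = λ w → P w ≡ # 4 × c w ≡ j'}
      (λ w → outer? (P w) ×-dec (c w ≟ j)) (λ w → (P w ≟ # 4) ×-dec (c w ≟ j'))

    outer-≢j' : ∀ {y} → Outer (P y) → c y ≢ j'
    outer-≢j' {y} o cy with outerPair-cover ends o
    ... | inj₁ py = j'∉Aᵢ (y , py , cy)
    ... | inj₂ py =
      col y u₅ (outer-complete-A₅ (outerPair-outerʳ ends) py u₅∈A₅) (trans cy (sym cu₅))

    T-closed : ∀ {x y} → Outer (P x) × c x ≡ j → Edge G x y → c y ≡ j' → P y ≡ # 4 × c y ≡ j'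
    T-closed (o , _) e cy with outer-neighbour o refl e
    ... | inj₁ py = ⊥-elim (outer-≢j' (subst Outer (sym py) o) cy)
    ... | inj₂ (inj₁ py) = py , cy
    ... | inj₂ (inj₂ f) = ⊥-elim (completeToA₆-≢j' f cy)

    S-closed : ∀ {x y} → P x ≡ # 4 × c x ≡ j' → Edge G x y → c y ≡ j → Outer (P y) × c y ≡ j
    S-closed {y = y} (px , _) e cy with A₅-neighbour px e
    ... | inj₁ o = o , cy
    ... | inj₂ (inj₁ py) = ⊥-elim (A₅-≢j py cy)
    ... | inj₂ (inj₂ py) = ⊥-elim (j∉A₆ (y , py , cy))

    j∉Aᵢ : ¬ UsesColor G P recolor i j
    j∉Aᵢ (w , w∈Aᵢ , rw) with recolor-cases w
    ... | inj₁ (_ , r) = j≢j' (trans (sym rw) r)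
    ... | inj₂ (inj₁ (_ , (p4 , _) , _)) = outer≢A₅ (outerᵢ w∈Aᵢ) p4
    ... | inj₂ (inj₂ (¬t , _ , r)) = ¬t (outerᵢ w∈Aᵢ , trans (sym r) rw)

    recolor-v : recolor v ≡ j'
    recolor-v with recolor-cases v
    ... | inj₁ (_ , r) = r
    ... | inj₂ (inj₁ (_ , (p4 , _) , _)) = ⊥-elim (outer≢A₅ (outerᵢ v∈Aᵢ) p4)
    ... | inj₂ (inj₂ (¬t , _)) = ⊥-elim (¬t (outerᵢ v∈Aᵢ , cv))

    recolor-u₆ : recolor u₆ ≡ j'
    recolor-u₆ with recolor-cases u₆
    ... | inj₁ (_ , r) = r
    ... | inj₂ (inj₁ (_ , (p4 , _) , _)) with () ← trans (sym p4) u₆∈A₆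
    recolor-u₆ | inj₂ (inj₂ (_ , _ , r)) = trans r cu₆

    swapAt : ∀ w → ¬ (P w ≡ i' × c w ≡ j) → SwapAt G P c i j j' w (recolor w)
    swapAt w ¬A' with recolor-cases w
    ... | inj₁ ((o , cw) , r) with outerPair-cover ends o
    ...   | inj₁ pw = inj₁ (pw , cw , r)
    ...   | inj₂ pw = ⊥-elim (¬A' (pw , cw))
    swapAt w ¬A' | inj₂ (inj₁ (_ , (p4 , c4) , r)) = inj₂ (inj₁ (p4 , c4 , r))
    swapAt w ¬A' | inj₂ (inj₂ (¬t , ¬s , r)) =
      inj₂ (inj₂ ((λ (pw , cw) → ¬t (outerᵢ pw , cw)) , ¬s , r))

    recolor-Aᵢ' : ∀ w → P w ≡ i' → c w ≡ j → recolor w ≡ j'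
    recolor-Aᵢ' w pw cw with recolor-cases w
    ... | inj₁ (_ , r) = r
    ... | inj₂ (inj₁ (_ , (_ , c4) , _)) = ⊥-elim (j≢j' (trans (sym cw) c4))
    ... | inj₂ (inj₂ (¬t , _)) = ⊥-elim (¬t (subst Outer (sym pw) (outerPair-outerʳ ends) , cw))

  exchange : Σ (Vertex G → Fin k) Exchanged
  exchange with any? (λ u → (P u ≟ # 4) ×-dec (c u ≟ j'))
  ... | yes (u₅ , u₅∈A₅ , cu₅) = swapWithA₅ u₅∈A₅ cu₅
  ... | no j'∉A₅ = recolorVertex j'∉A₅

lemma5 : (G : Graph) (P : Part G) → GemCogemFree G → SixStructure G P →
    (k : ℕ) → ChromaticNumber G k →
    (c : Vertex G → Fin k) → IsColoring G k c →
    (i i' : Fin 6) → ((i ≡ # 0 × i' ≡ # 3) ⊎ (i ≡ # 3 × i' ≡ # 0)) →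
    (j j' : Fin k) →
    UsesColor G P c (# 5) j' → ¬ UsesColor G P c i j' →
    UsesColor G P c i j → ¬ UsesColor G P c (# 5) j →
    Σ (Vertex G → Fin k) λ c' → IsColoring G k c'
      × ¬ UsesColor G P c' i j × UsesColor G P c' i j' × UsesColor G P c' (# 5) j'
      × (OpI G P c c' i j j' ⊎ OpII G P c c' i i' j j')
lemma5 G P _ St k _ c col i i' ends j j' (u₆ , u₆∈A₆ , cu₆) j'∉Aᵢ (v , v∈Aᵢ , cv) j∉A₆ =
  Recoloring.exchange St c col ends u₆∈A₆ cu₆ j'∉Aᵢ v∈Aᵢ cv j∉A₆
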